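{- Let $1 \le q \le w$ be integers and let $Q \subseteq [w]$ with $|Q|=q$. Let $Y$ and $Z$ be finite totally ordered sets and let $A_1,\dots,A_r$ be $q$-element subsets of $Y$. If $|Z| \ge |Y| + r(w-q)$, then there exist an injection $\pi\colon Y \to Z$ and $w$-element subsets $W_1, \dots, W_r$ of $Z$ such that for every $i \in [r]$, $Q$ selects $\pi(A_i)$ in $W_i$, and moreover $W_i \cap W_j = \pi(A_i \cap A_j)$ for all $i \neq j$ in $[r]$.
   Context: $[w]=\{1,\dots,w\}$. For $Q\subseteq[w]$ and a totally ordered set $W$ with elements $e_1<e_2<\dots<e_w$, the subset selected by $Q$ in $W$ is $\{e_i: i\in Q\}$; "$Q$ selects $B$ in $W$" means $B$ is this subset. For a map $\pi$ and a set $A$, $\pi(A)=\{\pi(a):a\in A\}$. -}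

module Defs where

open import Data.Nat using (ℕ)
open import Data.Fin using (Fin; _<_)
open import Data.Fin.Subset using (Subset; _∈_)
open import Data.Product using (Σ; ∃; _×_)
open import Function.Bundles using (_⇔_)
open import Relation.Binary.PropositionalEquality using (_≡_)

-- Finite totally ordered sets are represented (up to order isomorphism) by Fin n
-- with its natural order; subsets by Data.Fin.Subset.

Image : ∀ {m n} → (Fin m → Fin n) → Subset m → Fin n → Set
Image π A z = ∃ λ a → a ∈ A × π a ≡ z

-- Q ⊆ [w] (with [w] indexed by Fin w, i.e. shifted by one) selects the set B
-- (given as a predicate) in W ⊆ Fin n: writing W = {e_0 < e_1 < … < e_{w-1}},
-- B = {e_i : i ∈ Q}.  Here e is the (necessarily unique) strictly increasing
-- enumeration of W.
Selects : ∀ {w n} → Subset w → (Fin n → Set) → Subset n → Set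
Selects {w} {n} Q B W =
  Σ (Fin w → Fin n) λ e →
    (∀ i j → i < j → e i < e j)
    × (∀ z → (z ∈ W) ⇔ (∃ λ i → e i ≡ z))
    × (∀ z → B z ⇔ (∃ λ i → i ∈ Q × e i ≡ z))

-- Scan Z from left to right, keeping for every i the part of Q that W_i still has to realise.
-- If some W_i must next skip a position of Q, the next element of Z is spent on W_i alone;
-- otherwise it becomes the image of the next element y of Y and joins exactly those W_i with
-- y ∈ A_i.  Elements of the first kind lie in a single W_i, which gives W_i ∩ W_j = π(A_i ∩ A_j).
-- Each step uses up either an element of Y or one of the r (w − q) skipped positions, so
-- |Y| + r (w − q) elements of Z suffice.
module Submission where

open import Defs
open import Data.Bool using (Bool; true; false; T) renaming (_≟_ to _≟ᵇ_)
open import Data.Bool.Properties using (T-∧)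
open import Data.Empty using (⊥-elim)
open import Data.Fin as Fin using (Fin; zero; suc; _<_; lift; _≟_)
open import Data.Fin.Properties using (any?; suc-injective; lift-injective)
open import Data.Fin.Subset using (Subset; inside; outside; _∈_; _∩_; ∁; ∣_∣; ⊥)
open import Data.Fin.Subset.Properties using (drop-there; ∉⊥; ∣⊥∣≡0; x∈p∩q⁻; ∣∁p∣≡n∸∣p∣; ∣p∣≤n)
open import Data.Nat using (ℕ; zero; suc; _+_; _*_; _∸_; _≤_; z≤n; s≤s; s<s) renaming (_<_ to _<ℕ_)
open import Data.Nat.Properties as ℕ
  using (+-0-monoid; ≤-refl; ≤-trans; <-≤-trans; n≤1+n; n≤0⇒n≡0; +-mono-≤; +-mono-<-≤; +-mono-≤-<; +-monoʳ-≤; +-monoʳ-<)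
open import Algebra.Properties.Monoid.Sum +-0-monoid using (sum)
open import Data.Product using (Σ; ∃; _×_; _,_; proj₁; uncurry)
open import Data.Vec using ([]; _∷_; head; tail; here; there)
open import Function using (_∘_)
open import Function.Bundles using (_⇔_; mk⇔; Equivalence)
open import Function.Definitions using (Injective)
open import Function.Properties.Equivalence using () renaming (trans to ⇔-trans; sym to ⇔-sym)
open import Relation.Nullary using (¬_; Dec; yes; no)
open import Relation.Nullary.Decidable using (⌊_⌋; toWitness; fromWitness)
open import Relation.Binary.PropositionalEquality
  using (_≡_; _≢_; refl; sym; trans; cong; subst; module ≡-Reasoning)

open Equivalence

private
  variable
    m n r : ℕ
    b t : Bool
    z : Fin n
    V : Subset n
    f : Fin m → Fin n

⇔-cases : {B₁ B₂ : Fin (suc n) → Set} {C : Set} {D : Fin n → Set} →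
  (B₁ zero ⇔ C) → (B₂ zero ⇔ C) → (∀ z → B₁ (suc z) ⇔ D z) → (∀ z → B₂ (suc z) ⇔ D z) →
  ∀ z → B₁ z ⇔ B₂ z
⇔-cases h₁ h₂ _ _ zero = ⇔-trans h₁ (⇔-sym h₂)
⇔-cases _ _ h₁ h₂ (suc z) = ⇔-trans (h₁ z) (⇔-sym (h₂ z))

¬⇒⇔⊥ : {X : Set} → ¬ X → X ⇔ T false
¬⇒⇔⊥ ¬x = mk⇔ ¬x (λ ())

zero∈∷⇔T : {p : Subset n} → zero ∈ (b ∷ p) ⇔ T b
zero∈∷⇔T {b = true} = mk⇔ _ (λ _ → here)
zero∈∷⇔T {b = false} = mk⇔ (λ ()) (λ ())

suc∈∷⇔∈ : {p : Subset n} → suc z ∈ (b ∷ p) ⇔ z ∈ p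
suc∈∷⇔∈ = mk⇔ drop-there there

∈-∷⇔ : {B : Fin n → Set} {B′ : Fin (suc n) → Set} →
  (∀ z → z ∈ V ⇔ B z) → (∀ z → B′ (suc z) ⇔ B z) → (B′ zero ⇔ T b) →
  ∀ z → z ∈ (b ∷ V) ⇔ B′ z
∈-∷⇔ V⇔B B′-suc B′-zero = ⇔-cases zero∈∷⇔T B′-zero (λ z → ⇔-trans suc∈∷⇔∈ (V⇔B z)) B′-suc

sum-mono-≤ : {f g : Fin r → ℕ} → (∀ j → f j ≤ g j) → sum f ≤ sum g
sum-mono-≤ {zero} _ = z≤n
sum-mono-≤ {suc r} f≤g = +-mono-≤ (f≤g zero) (sum-mono-≤ (f≤g ∘ suc))

sum-mono-< : {f g : Fin r → ℕ} (i : Fin r) → (∀ j → f j ≤ g j) → f i <ℕ g i → sum f <ℕ sum g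
sum-mono-< zero f≤g fi<gi = +-mono-<-≤ fi<gi (sum-mono-≤ (f≤g ∘ suc))
sum-mono-< (suc i) f≤g fi<gi = +-mono-≤-< (f≤g zero) (sum-mono-< i (f≤g ∘ suc) fi<gi)

sum-const : ∀ r c → sum {r} (λ _ → c) ≡ r * c
sum-const zero c = refl
sum-const (suc r) c = cong (c +_) (sum-const r c)

_≡ᵇ_ : Fin r → Fin r → Bool
j ≡ᵇ i = ⌊ j ≟ i ⌋

≡ᵇ⇒≡ : {i j : Fin r} → T (j ≡ᵇ i) → j ≡ i
≡ᵇ⇒≡ = toWitness

≡⇒≡ᵇ : {i j : Fin r} → j ≡ i → T (j ≡ᵇ i)
≡⇒≡ᵇ = fromWitness

Range : (Fin m → Fin n) → Fin n → Set
Range f z = ∃ λ i → f i ≡ z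

Range-suc-zero : ¬ Range (Fin.suc ∘ f) zero
Range-suc-zero (_ , ())

Range-suc-suc : Range (Fin.suc ∘ f) (suc z) ⇔ Range f z
Range-suc-suc = mk⇔ (λ (i , p) → i , suc-injective p) (λ (i , p) → i , cong suc p)

Range-lift-zero : Range (lift 1 f) zero
Range-lift-zero = zero , refl

Range-lift-suc : Range (lift 1 f) (suc z) ⇔ Range f z
Range-lift-suc = mk⇔ (λ { (zero , ()) ; (suc i , p) → i , suc-injective p }) (λ (i , p) → suc i , cong suc p)

Image-suc-zero : {A : Subset m} → ¬ Image (Fin.suc ∘ f) A zero
Image-suc-zero (_ , _ , ())

Image-suc-suc : {A : Subset m} → Image (Fin.suc ∘ f) A (suc z) ⇔ Image f A z
Image-suc-suc = mk⇔ (λ (a , a∈A , p) → a , a∈A , suc-injective p) (λ (a , a∈A , p) → a , a∈A , cong suc p)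

Image-lift-zero : (A : Subset (suc m)) → Image (lift 1 f) A zero ⇔ T (head A)
Image-lift-zero (b ∷ A) =
  mk⇔ (λ { (zero , a∈A , _) → to zero∈∷⇔T a∈A ; (suc _ , _ , ()) }) (λ t → zero , from zero∈∷⇔T t , refl)

Image-lift-suc : (A : Subset (suc m)) → Image (lift 1 f) A (suc z) ⇔ Image f (tail A) z
Image-lift-suc (b ∷ A) =
  mk⇔ (λ { (zero , _ , ()) ; (suc a , a∈A , p) → a , drop-there a∈A , suc-injective p })
      (λ (a , a∈A , p) → suc a , there a∈A , cong suc p)

∩-lift⇔ : ∀ {V V′ : Subset n} (A A′ : Subset (suc m)) →
  (∀ z → z ∈ (V ∩ V′) ⇔ Image f (tail A ∩ tail A′) z) →
  ∀ z → z ∈ ((head A ∷ V) ∩ (head A′ ∷ V′)) ⇔ Image (lift 1 f) (A ∩ A′) z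
∩-lift⇔ A@(_ ∷ _) A′@(_ ∷ _) V∩V′⇔ = ∈-∷⇔ V∩V′⇔ (λ _ → Image-lift-suc (A ∩ A′)) (Image-lift-zero (A ∩ A′))

StrictlyMonotone : (Fin m → Fin n) → Set
StrictlyMonotone e = ∀ i j → i < j → e i < e j

lift-strictlyMonotone : {e : Fin m → Fin n} → StrictlyMonotone e → StrictlyMonotone (lift 1 e)
lift-strictlyMonotone e-mono zero (suc j) _ = s≤s z≤n
lift-strictlyMonotone e-mono (suc i) (suc j) (s<s i<j) = s<s (e-mono i j i<j)

module _ {w} {Q : Subset w} {B : Fin n → Set} {B′ : Fin (suc n) → Set} where

  Selects-outside : Selects Q B V → (∀ z → B′ (suc z) ⇔ B z) → ¬ B′ zero → Selects Q B′ (outside ∷ V)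
  Selects-outside (e , e-mono , V⇔ , B⇔) B′-suc ¬B′-zero =
    Fin.suc ∘ e , (λ i j → s<s ∘ e-mono i j) ,
    ∈-∷⇔ V⇔ (λ _ → Range-suc-suc) (¬⇒⇔⊥ Range-suc-zero) ,
    ⇔-cases (¬⇒⇔⊥ ¬B′-zero) (¬⇒⇔⊥ Image-suc-zero) (λ z → ⇔-trans (B′-suc z) (B⇔ z)) (λ _ → Image-suc-suc)

  Selects-inside : Selects Q B V → (∀ z → B′ (suc z) ⇔ B z) → (B′ zero ⇔ T b) → Selects (b ∷ Q) B′ (inside ∷ V)
  Selects-inside {b = b} (e , e-mono , V⇔ , B⇔) B′-suc B′-zero =
    lift 1 e , lift-strictlyMonotone e-mono ,
    ∈-∷⇔ V⇔ (λ _ → Range-lift-suc) (mk⇔ _ (λ _ → Range-lift-zero)) ,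
    ⇔-cases B′-zero (Image-lift-zero (b ∷ Q)) (λ z → ⇔-trans (B′-suc z) (B⇔ z)) (λ _ → Image-lift-suc (b ∷ Q))

Selects-[] : {B : Fin n → Set} → (∀ z → ¬ B z) → Selects [] B ⊥
Selects-[] ¬B = (λ ()) , (λ ()) , (λ z → mk⇔ (⊥-elim ∘ ∉⊥) (λ ())) , (λ z → mk⇔ (⊥-elim ∘ ¬B z) (λ ()))

-- The positions of Q that a set W_i still has to realise; `outside` marks a gap, which W_i must
-- fill with an element outside π(Y).
record Pattern : Set where
  constructor pat
  field
    {width} : ℕ
    marks : Subset width

open Pattern

gaps : Pattern → ℕ
gaps P = ∣ ∁ (marks P) ∣

data Opens (b : Bool) : Pattern → Set where
  opens : ∀ {w} {Q : Subset w} → Opens b (pat (b ∷ Q))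

opens? : ∀ b P → Dec (Opens b P)
opens? b (pat []) = no λ ()
opens? b (pat (c ∷ Q)) with b ≟ᵇ c
... | yes refl = yes opens
... | no b≢c = no λ { opens → b≢c refl }

-- advance true (pat []) is junk; it is only used on patterns with an Opens witness.
advance : Bool → Pattern → Pattern
advance false P = P
advance true (pat []) = pat []
advance true (pat (_ ∷ Q)) = pat Q

private
  variable
    P : Pattern

advance-width : (T t → Opens b P) → ∣ V ∣ ≡ width (advance t P) → ∣ t ∷ V ∣ ≡ width P
advance-width {t = false} _ eq = eq
advance-width {t = true} column eq with column _
... | opens = cong suc eq

gaps-advance-≤ : ∀ t P → gaps (advance t P) ≤ gaps P
gaps-advance-≤ false P = ≤-refl
gaps-advance-≤ true (pat []) = ≤-refl
gaps-advance-≤ true (pat (inside ∷ Q)) = ≤-refl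
gaps-advance-≤ true (pat (outside ∷ Q)) = n≤1+n _

gaps-advance-< : T t → Opens outside P → gaps (advance t P) <ℕ gaps P
gaps-advance-< {t = true} _ opens = ≤-refl

sum-gaps-advance-≤ : (t : Fin r → Bool) (P : Fin r → Pattern) →
  sum (λ j → gaps (advance (t j) (P j))) ≤ sum (gaps ∘ P)
sum-gaps-advance-≤ t P = sum-mono-≤ (λ j → gaps-advance-≤ (t j) (P j))

sum-gaps-advance-< : (t : Fin r → Bool) (P : Fin r → Pattern) (i : Fin r) → T (t i) → Opens outside (P i) →
  sum (λ j → gaps (advance (t j) (P j))) <ℕ sum (gaps ∘ P)
sum-gaps-advance-< t P i ti opens-i = sum-mono-< i (λ j → gaps-advance-≤ (t j) (P j)) (gaps-advance-< ti opens-i)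

card-advance-gap : (T t → Opens outside P) → ∣ marks (advance t P) ∣ ≡ ∣ marks P ∣
card-advance-gap {t = false} _ = refl
card-advance-gap {t = true} column with column _
... | opens = refl

card-advance-mark : (A : Subset (suc m)) → (T (head A) → Opens inside P) →
  ∣ marks P ∣ ≡ ∣ A ∣ → ∣ marks (advance (head A) P) ∣ ≡ ∣ tail A ∣
card-advance-mark (false ∷ A) _ eq = eq
card-advance-mark (true ∷ A) column eq with column _
... | opens = ℕ.suc-injective eq

opens-inside : {A : Subset (suc m)} → ¬ Opens outside P → ∣ marks P ∣ ≡ ∣ A ∣ → T (head A) → Opens inside P
opens-inside {P = pat []} {A = true ∷ _} _ () _
opens-inside {P = pat (inside ∷ _)} _ _ _ = opens
opens-inside {P = pat (outside ∷ _)} no-gap _ _ = ⊥-elim (no-gap opens)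

no-gap-no-mark⇒empty : ¬ Opens outside P → ∣ marks P ∣ ≡ 0 → P ≡ pat []
no-gap-no-mark⇒empty {pat []} _ _ = refl
no-gap-no-mark⇒empty {pat (outside ∷ Q)} no-gap _ = ⊥-elim (no-gap opens)
no-gap-no-mark⇒empty {pat (inside ∷ Q)} _ ()

module _ {B : Fin n → Set} {B′ : Fin (suc n) → Set} (B′-suc : ∀ z → B′ (suc z) ⇔ B z) where

  Selects-advance-gap : (T t → Opens outside P) → ¬ B′ zero →
    Selects (marks (advance t P)) B V → Selects (marks P) B′ (t ∷ V)
  Selects-advance-gap {t = false} _ ¬B′-zero S = Selects-outside S B′-suc ¬B′-zero
  Selects-advance-gap {t = true} column ¬B′-zero S with column _
  ... | opens = Selects-inside S B′-suc (¬⇒⇔⊥ ¬B′-zero)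

  Selects-advance-mark : (T t → Opens inside P) → (B′ zero ⇔ T t) →
    Selects (marks (advance t P)) B V → Selects (marks P) B′ (t ∷ V)
  Selects-advance-mark {t = false} _ B′-zero S = Selects-outside S B′-suc (to B′-zero)
  Selects-advance-mark {t = true} column B′-zero S with column _
  ... | opens = Selects-inside S B′-suc B′-zero

record Realisation (n : ℕ) (P : Fin r → Pattern) (A : Fin r → Subset m) : Set where
  field
    π : Fin m → Fin n
    π-injective : Injective _≡_ _≡_ π
    W : Fin r → Subset n
    ∣W∣≡width : ∀ i → ∣ W i ∣ ≡ width (P i)
    selects : ∀ i → Selects (marks (P i)) (Image π (A i)) (W i)
    intersection : ∀ i j → i ≢ j → ∀ z → z ∈ (W i ∩ W j) ⇔ Image π (A i ∩ A j) z

module _ {P : Fin r → Pattern} {A : Fin r → Subset m} (t : Fin r → Bool) where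

  gap-step : (∀ j → T (t j) → Opens outside (P j)) → (∀ j k → T (t j) → T (t k) → j ≡ k) →
    Realisation n (λ j → advance (t j) (P j)) A → Realisation (suc n) P A
  gap-step column unique R = record
    { π = Fin.suc ∘ π
    ; π-injective = π-injective ∘ suc-injective
    ; W = λ j → t j ∷ W j
    ; ∣W∣≡width = λ j → advance-width {V = W j} (column j) (∣W∣≡width j)
    ; selects = λ j → Selects-advance-gap (λ _ → Image-suc-suc) (column j) Image-suc-zero (selects j)
    ; intersection = λ j k j≢k → ∈-∷⇔ (intersection j k j≢k) (λ _ → Image-suc-suc)
        (mk⇔ (⊥-elim ∘ Image-suc-zero) (λ both → ⊥-elim (j≢k (uncurry (unique j k) (to (T-∧ {t j}) both)))))
    }
    where open Realisation R

module _ {P : Fin r → Pattern} {A : Fin r → Subset (suc m)} where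

  mark-step : (∀ j → T (head (A j)) → Opens inside (P j)) →
    Realisation n (λ j → advance (head (A j)) (P j)) (tail ∘ A) → Realisation (suc n) P A
  mark-step column R = record
    { π = lift 1 π
    ; π-injective = lift-injective π π-injective 1
    ; W = λ j → head (A j) ∷ W j
    ; ∣W∣≡width = λ j → advance-width {V = W j} (column j) (∣W∣≡width j)
    ; selects = λ j → Selects-advance-mark (λ _ → Image-lift-suc (A j)) (column j) (Image-lift-zero (A j)) (selects j)
    ; intersection = λ j k j≢k → ∩-lift⇔ (A j) (A k) (intersection j k j≢k)
    }
    where open Realisation R

module _ {P : Fin r → Pattern} {A : Fin r → Subset 0} where

  empty-realisation : (∀ j → ¬ Opens outside (P j)) → (∀ j → ∣ marks (P j) ∣ ≡ ∣ A j ∣) → Realisation n P A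
  empty-realisation {n = n} no-gap card = record
    { π = λ ()
    ; π-injective = λ { {()} }
    ; W = λ _ → ⊥
    ; ∣W∣≡width = λ j → trans (∣⊥∣≡0 n) (cong width (sym (empty j)))
    ; selects = λ j → subst (λ Q → Selects (marks Q) (Image (λ ()) (A j)) ⊥) (sym (empty j)) (Selects-[] λ _ ())
    ; intersection = λ _ _ _ _ → mk⇔ (⊥-elim ∘ ∉⊥ ∘ proj₁ ∘ x∈p∩q⁻ ⊥ ⊥) (λ ())
    }
    where
    empty : ∀ j → P j ≡ pat []
    empty j = no-gap-no-mark⇒empty (no-gap j) (trans (card j) (n≤0⇒n≡0 (∣p∣≤n (A j))))

realise : ∀ n {m r} (P : Fin r → Pattern) (A : Fin r → Subset m) →
  (∀ j → ∣ marks (P j) ∣ ≡ ∣ A j ∣) → m + sum (gaps ∘ P) ≤ n → Realisation n P A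
realise n P A card budget with any? (opens? outside ∘ P)
realise n {m} P A card budget | yes (i , opens-i)
  with <-≤-trans (+-monoʳ-< m (sum-gaps-advance-< (_≡ᵇ i) P i (≡⇒≡ᵇ refl) opens-i)) budget
... | s≤s budget′ = gap-step (_≡ᵇ i) column unique
  (realise _ _ A (λ j → trans (card-advance-gap (column j)) (card j)) budget′)
  where
  column : ∀ j → T (j ≡ᵇ i) → Opens outside (P j)
  column j j≡i = subst (Opens outside ∘ P) (sym (≡ᵇ⇒≡ j≡i)) opens-i
  unique : ∀ j k → T (j ≡ᵇ i) → T (k ≡ᵇ i) → j ≡ k
  unique j k j≡i k≡i = trans (≡ᵇ⇒≡ j≡i) (sym (≡ᵇ⇒≡ k≡i))
realise n {zero} P A card budget | no no-gap = empty-realisation (λ j → no-gap ∘ (j ,_)) card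
realise zero {suc m} P A card () | no _
realise (suc n) {suc m} P A card (s≤s budget) | no no-gap = mark-step column
  (realise n _ (tail ∘ A) (λ j → card-advance-mark (A j) (column j) (card j))
    (≤-trans (+-monoʳ-≤ m (sum-gaps-advance-≤ (head ∘ A) P)) budget))
  where
  column : ∀ j → T (head (A j)) → Opens inside (P j)
  column j = opens-inside {A = A j} (no-gap ∘ (j ,_)) (card j)

mainTheorem14 : (w q m n r : ℕ) → 1 ≤ q → q ≤ w →
    (Q : Subset w) → ∣ Q ∣ ≡ q →
    (A : Fin r → Subset m) → (∀ i → ∣ A i ∣ ≡ q) →
    m + r * (w ∸ q) ≤ n →
    Σ (Fin m → Fin n) λ π →
      Injective _≡_ _≡_ π
      × Σ (Fin r → Subset n) λ W →
          (∀ i → ∣ W i ∣ ≡ w)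
          × (∀ i → Selects Q (Image π (A i)) (W i))
          × (∀ i j → i ≢ j → ∀ z → (z ∈ (W i ∩ W j)) ⇔ Image π (A i ∩ A j) z)
mainTheorem14 w q m n r _ _ Q ∣Q∣≡q A ∣A∣≡q budget =
  π , π-injective , W , ∣W∣≡width , selects , intersection
  where
  open ≡-Reasoning
  total-gaps : sum {r} (λ _ → gaps (pat Q)) ≡ r * (w ∸ q)
  total-gaps = begin
    sum {r} (λ _ → ∣ ∁ Q ∣) ≡⟨ sum-const r _ ⟩
    r * ∣ ∁ Q ∣            ≡⟨ cong (r *_) (∣∁p∣≡n∸∣p∣ Q) ⟩
    r * (w ∸ ∣ Q ∣)        ≡⟨ cong (λ k → r * (w ∸ k)) ∣Q∣≡q ⟩
    r * (w ∸ q)            ∎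
  open Realisation (realise n (λ _ → pat Q) A (λ i → trans ∣Q∣≡q (sym (∣A∣≡q i)))
    (subst (λ k → m + k ≤ n) (sym total-gaps) budget))
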